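{- Let $r \geq 0$ and $k \geq 2$ be integers. Then the treewidth of the primal graph of the CNF $F_{r,k}$ is at most $2k-1$.
   Context: For a graph $G$, the CNF $CNF(G)$ has a variable $X_u$ for each vertex $u \in V(G)$ and a variable $X_{u,v}=X_{v,u}$ for each edge $\{u,v\} \in E(G)$; its clauses are $(X_u \vee X_{u,v} \vee X_v)$, one for each edge $\{u,v\} \in E(G)$. Let $T_r$ be the complete (rooted) binary tree of height $r$ (it has $2^{r+1}-1$ nodes). Let $CT_{r,k}$ be the graph obtained from $T_r$ by replacing each node $a$ by a clique $K_a$ of size $k$ (the cliques being pairwise disjoint) and, for each edge $\{a,b\}$ of $T_r$, making every vertex of $K_a$ adjacent to every vertex of $K_b$. Define $F_{r,k}=CNF(CT_{r,k})$. The primal graph of a CNF has the variables as vertices, two being adjacent iff they occur together in some clause. -}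

module Defs where

open import Data.Nat using (ℕ; zero; suc; _≤_; _<_; _*_; _∸_)
open import Data.Fin using (Fin; toℕ) renaming (suc to fsuc)
open import Data.Bool using (Bool)
open import Data.List using (List; []; _∷_; length)
open import Data.List.Membership.Propositional using (_∈_)
open import Data.Product using (Σ; ∃; _×_; _,_; proj₁)
open import Data.Sum using (_⊎_; inj₁; inj₂)
open import Relation.Binary.PropositionalEquality using (_≡_; _≢_)
open import Relation.Binary.Construct.Closure.ReflexiveTransitive using (Star)

-- Graphs: a vertex type and an edge type with endpoints.
-- u and v are adjacent iff some edge has endpoints (u , v) or (v , u).

record Graph : Set₁ where
  field
    V    : Set
    Ed   : Set
    ends : Ed → V × V
open Graph public

-- Finite (nonempty) trees, given by parent pointers: the nodes are
-- Fin (suc m), node 0 is the root, and node (fsuc i) has parent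
-- (parent i), which has a smaller index.  Every finite nonempty tree is
-- isomorphic to such a tree (number the nodes in BFS order).

record Tree : Set where
  field
    m        : ℕ
    parent   : Fin m → Fin (suc m)
    parent<  : ∀ i → toℕ (parent i) ≤ toℕ i
open Tree public

Node : Tree → Set
Node T = Fin (suc (m T))

TreeAdj : (T : Tree) → Node T → Node T → Set
TreeAdj T a b = ∃ λ i → (a ≡ fsuc i × b ≡ parent T i) ⊎ (b ≡ fsuc i × a ≡ parent T i)

record TreeDecomposition (G : Graph) : Set₁ where
  field
    tree : Tree
    bag  : Node tree → List (V G)
    cover-vertex : ∀ (v : V G) → ∃ λ t → v ∈ bag t
    cover-edge   : ∀ (e : Ed G) → ∃ λ t →
                     proj₁ (ends G e) ∈ bag t × Data.Product.proj₂ (ends G e) ∈ bag t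
    connected    : ∀ (v : V G) (s t : Node tree) → v ∈ bag s → v ∈ bag t →
                     Star (λ a b → TreeAdj tree a b × v ∈ bag a × v ∈ bag b) s t
open TreeDecomposition public

-- width of a decomposition is ≤ w iff every bag has at most w+1 elements
-- (bags are lists; duplicates only make the bound harder to meet)
WidthAtMost : {G : Graph} → TreeDecomposition G → ℕ → Set
WidthAtMost D w = ∀ t → length (bag D t) ≤ suc w

TreewidthAtMost : Graph → ℕ → Set₁
TreewidthAtMost G w = Σ (TreeDecomposition G) λ D → WidthAtMost D w

Literal : Set → Set
Literal A = A × Bool   -- (variable , polarity)

record CNF : Set₁ where
  field
    Var    : Set
    Cl     : Set
    clause : Cl → List (Literal Var)
open CNF public

OccursIn : {A : Set} → A → List (Literal A) → Set
OccursIn x c = ∃ λ b → (x , b) ∈ c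

Primal : CNF → Graph
Primal F = record
  { V    = Var F
  ; Ed   = Σ (Cl F) λ c → Σ (Var F) λ x → Σ (Var F) λ y →
             x ≢ y × OccursIn x (clause F c) × OccursIn y (clause F c)
  ; ends = λ { (c , x , y , _) → x , y }
  }

CNFof : Graph → CNF
CNFof G = record
  { Var    = V G ⊎ Ed G
  ; Cl     = Ed G
  ; clause = λ e → (inj₁ (proj₁ (ends G e)) , Bool.true)
                 ∷ (inj₂ e , Bool.true)
                 ∷ (inj₁ (Data.Product.proj₂ (ends G e)) , Bool.true) ∷ []
  }
  where import Data.Bool as Bool

-- The complete binary tree T_r: nodes are root-to-node paths, written
-- as lists of Bool (most recent step first) of length ≤ r.  The children
-- of node p are (b ∷ p).  It has 2^(r+1) - 1 nodes.

TNode : ℕ → Set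
TNode r = Σ (List Bool) λ p → length p ≤ r

-- Edges (each unordered edge listed exactly once):
--   * inside the clique K_a : (a , i) — (a , j) for i < j
--   * between K_a and K_{b∷a} (b ∷ a a child of a): (a , i) — (b ∷ a , j)
data CTEdge (r k : ℕ) : Set where
  inClique : (a : TNode r) (i j : Fin k) → toℕ i < toℕ j → CTEdge r k
  across   : (a : List Bool) (b : Bool) → length (b ∷ a) ≤ r →
             (i j : Fin k) → CTEdge r k

CT : ℕ → ℕ → Graph
CT r k = record
  { V    = TNode r × Fin k
  ; Ed   = CTEdge r k
  ; ends = ends'
  }
  where
  open import Data.Nat.Properties using (≤-trans; n≤1+n)
  ends' : CTEdge r k → (TNode r × Fin k) × (TNode r × Fin k)
  ends' (inClique a i j _) = (a , i) , (a , j)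
  ends' (across a b le i j) = ((a , ≤-trans (n≤1+n (length a)) le) , i) , ((b ∷ a , le) , j)

F : ℕ → ℕ → CNF
F r k = CNFof (CT r k)

-- Hang every clause (X_u ∨ X_uv ∨ X_v) of F_{r,k} as a leaf below the deeper of the
-- cliques K_u, K_v it touches, and give each node a of the binary tree T_r the bag
-- K_a ∪ K_parent(a).  Node bags have 2k elements and leaf bags 3 ≤ 2k.  A clique
-- variable X_(a,i) lies only in the bags of a, of the children of a and of leaves
-- hanging below a or its children; from each of them one reaches a by moving to the
-- parent, so these bags form a subtree.  An edge variable lies in a single leaf.
-- To fit the parent-pointer format of trees, the nodes of T_r are numbered
-- breadth first and the leaves after them, in mixed radix over their parent.
module Submission where

open import Defs
open import Data.Nat using (ℕ; _≤_; _*_; _∸_)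
open import Data.Nat using (zero; suc; pred; _+_; _<_; _^_; _/_; _%_; z≤n; s≤s; _<?_; _≟_; NonZero)
open import Data.Nat.Properties
open import Data.Nat.DivMod
open import Data.Nat.Divisibility using (n∣m*n)
open import Data.Nat.Induction using (<-wellFounded)
open import Induction.WellFounded using (Acc; acc)
open import Data.Fin using (Fin; toℕ) renaming (suc to fsuc; zero to fzero)
open import Data.Fin.Properties using (toℕ-injective; toℕ-fromℕ<; toℕ<n; toℕ≤pred[n])
open import Data.Bool using (Bool; true; false)
open import Data.List using (List; []; _∷_; length; map; _++_; tabulate)
open import Data.List.Membership.Propositional using (_∈_)
open import Data.List.Membership.Propositional.Properties
  using (∈-map⁺; ∈-++⁺ˡ; ∈-++⁺ʳ; ∈-++⁻; ∈-tabulate⁺; ∈-tabulate⁻)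
open import Data.List.Relation.Unary.Any using (here; there)
open import Data.List.Properties using (length-++; length-tabulate)
open import Data.Maybe using (Maybe; just; nothing)
import Data.Maybe as Maybe
open import Data.Product using (∃; _×_; _,_; proj₁; proj₂)
open import Data.Sum using (_⊎_; inj₁; inj₂)
open import Relation.Nullary using (yes; no; contradiction)
open import Function using (_∘′_)
open import Relation.Binary.PropositionalEquality
open import Relation.Binary.Construct.Closure.ReflexiveTransitive using (Star; ε; _◅_; _◅◅_; reverse)

[m+kn]%n≡m : ∀ m k n .{{_ : NonZero n}} → m < n → (m + k * n) % n ≡ m
[m+kn]%n≡m m k n m<n = trans ([m+kn]%n≡m%n m k n) (m<n⇒m%n≡m m<n)

[m+kn]/n≡k : ∀ m k n .{{_ : NonZero n}} → m < n → (m + k * n) / n ≡ k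
[m+kn]/n≡k m k n m<n = begin
  (m + k * n) / n    ≡⟨ +-distrib-/-∣ʳ m (n∣m*n k) ⟩
  m / n + k * n / n  ≡⟨ cong₂ _+_ (m<n⇒m/n≡0 m<n) (m*n/n≡m k n) ⟩
  k                  ∎
  where open ≡-Reasoning

toℕ-mod : ∀ {n} .{{_ : NonZero n}} (i : Fin n) → toℕ i mod n ≡ i
toℕ-mod i = toℕ-injective (trans (toℕ-fromℕ< _) (m<n⇒m%n≡m (toℕ<n i)))

[m+kn]mod-n≡m : ∀ {n} .{{_ : NonZero n}} (i : Fin n) k → (toℕ i + k * n) mod n ≡ i
[m+kn]mod-n≡m {n} i k = toℕ-injective (trans (toℕ-fromℕ< _) ([m+kn]%n≡m (toℕ i) k n (toℕ<n i)))

m+kn<pn : ∀ {m n k p} → m < n → k < p → m + k * n < p * n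
m+kn<pn {n = n} {k} m<n k<p = ≤-trans (+-monoˡ-< (k * n) m<n) (*-monoˡ-≤ n k<p)

fromBit : Bool → ℕ
fromBit false = 0
fromBit true  = 1

toBit : ℕ → Bool
toBit zero    = false
toBit (suc _) = true

fromBit<2 : ∀ b → fromBit b < 2
fromBit<2 false = s≤s z≤n
fromBit<2 true  = s≤s (s≤s z≤n)

-- Paths are read from the node upwards, so the children of p are numbered 2p+1, 2p+2.
index : List Bool → ℕ
index []      = 0
index (b ∷ p) = suc (fromBit b + index p * 2)

pathAt : (depth n : ℕ) → List Bool
pathAt zero      _       = []
pathAt (suc d)   zero    = []
pathAt (suc d)   (suc n) = toBit (n % 2) ∷ pathAt d (n / 2)

length-pathAt : ∀ d n → length (pathAt d n) ≤ d
length-pathAt zero    _       = z≤n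
length-pathAt (suc d) zero    = z≤n
length-pathAt (suc d) (suc n) = s≤s (length-pathAt d (n / 2))

toBit-[fromBit+2k]%2 : ∀ b k → toBit ((fromBit b + k * 2) % 2) ≡ b
toBit-[fromBit+2k]%2 false k rewrite [m+kn]%n≡m 0 k 2 (fromBit<2 false) = refl
toBit-[fromBit+2k]%2 true  k rewrite [m+kn]%n≡m 1 k 2 (fromBit<2 true)  = refl

pathAt-index : ∀ d p → length p ≤ d → pathAt d (index p) ≡ p
pathAt-index zero    []      _        = refl
pathAt-index (suc d) []      _        = refl
pathAt-index (suc d) (b ∷ p) (s≤s le) =
  cong₂ _∷_ (toBit-[fromBit+2k]%2 b (index p)) (trans parent-back (pathAt-index d p le))
  where
  parent-back : pathAt d ((fromBit b + index p * 2) / 2) ≡ pathAt d (index p)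
  parent-back = cong (pathAt d) ([m+kn]/n≡k (fromBit b) (index p) 2 (fromBit<2 b))

suc-index<2^ : ∀ p → suc (index p) < 2 ^ suc (length p)
suc-index<2^ []      = s≤s (s≤s z≤n)
suc-index<2^ (b ∷ p) = begin-strict
  suc (suc (fromBit b + index p * 2))  <⟨ s≤s (s≤s (+-monoˡ-< (index p * 2) (fromBit<2 b))) ⟩
  suc (suc (2 + index p * 2))          ≡⟨ cong (λ x → suc (suc x)) (*-distribʳ-+ 2 1 (index p)) ⟨
  suc (suc (suc (index p) * 2))        ≡⟨ *-distribʳ-+ 2 1 (suc (index p)) ⟨
  suc (suc (index p)) * 2              ≤⟨ *-monoˡ-≤ 2 (suc-index<2^ p) ⟩
  2 ^ suc (length p) * 2               ≡⟨ *-comm (2 ^ suc (length p)) 2 ⟩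
  2 ^ suc (length (b ∷ p))             ∎
  where open ≤-Reasoning

module _ {S A : Set} (encode : S → ℕ) (decode : ℕ → Maybe S)
         (decode-encode : ∀ x → decode (encode x) ≡ just x) where

  extend : (S → List A) → ℕ → List A
  extend f n with decode n
  ... | nothing = []
  ... | just x with encode x ≟ n
  ...   | yes _ = f x
  ...   | no _  = []

  extend-encode : ∀ f x → extend f (encode x) ≡ f x
  extend-encode f x rewrite decode-encode x | ≟-diag {encode x} refl = refl

  ∈-extend⁻ : ∀ f {n v} → v ∈ extend f n → ∃ λ x → encode x ≡ n × v ∈ f x
  ∈-extend⁻ f {n} v∈ with decode n
  ... | just x with encode x ≟ n
  ...   | yes eq = x , eq , v∈

  length-extend≤ : ∀ f {w} → (∀ x → length (f x) ≤ w) → ∀ n → length (extend f n) ≤ w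
  length-extend≤ f bound n with decode n
  ... | nothing = z≤n
  ... | just x with encode x ≟ n
  ...   | yes _ = bound x
  ...   | no _  = z≤n

-- Node suc n of the decomposition tree has parent up n; any two bags containing v are
-- connected through the home of v, reached from both by climbing.
module ClimbingDecomposition
  (G : Graph) (size : ℕ) (up : ℕ → ℕ) (up≤ : ∀ n → up n ≤ n)
  (bags : ℕ → List (V G)) (home : V G → ℕ)
  (home≤ : ∀ v → home v ≤ size) (∈-home : ∀ v → v ∈ bags (home v))
  (edge-in-bag : ∀ e → ∃ λ n → n ≤ size × proj₁ (ends G e) ∈ bags n × proj₂ (ends G e) ∈ bags n)
  (climb : ∀ {v n} → v ∈ bags n → n ≡ home v ⊎ ∃ λ n′ → n ≡ suc n′ × v ∈ bags (up n′))
  where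

  node : ℕ → Fin (suc size)
  node n = n mod suc size

  toℕ-node : ∀ {n} → n ≤ size → toℕ (node n) ≡ n
  toℕ-node n≤ = trans (toℕ-fromℕ< _) (m≤n⇒m%n≡m n≤)

  node-toℕ : ∀ (t : Fin (suc size)) → node (toℕ t) ≡ t
  node-toℕ t = toℕ-injective (toℕ-node (toℕ≤pred[n] t))

  ∈-bags-node : ∀ {v n} → n ≤ size → v ∈ bags n → v ∈ bags (toℕ (node n))
  ∈-bags-node n≤ = subst (_ ∈_) (sym (cong bags (toℕ-node n≤)))

  decompositionTree : Tree
  decompositionTree = record
    { m       = size
    ; parent  = λ i → node (up (toℕ i))
    ; parent< = λ i → ≤-trans (≤-reflexive (toℕ-fromℕ< _)) (≤-trans (m%n≤m _ (suc size)) (up≤ (toℕ i)))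
    }

  bag′ : Fin (suc size) → List (V G)
  bag′ t = bags (toℕ t)

  Linked : V G → Fin (suc size) → Fin (suc size) → Set
  Linked v s t = TreeAdj decompositionTree s t × v ∈ bag′ s × v ∈ bag′ t

  Linked-sym : ∀ {v s t} → Linked v s t → Linked v t s
  Linked-sym ((i , inj₁ eqs) , vs , vt) = (i , inj₂ eqs) , vt , vs
  Linked-sym ((i , inj₂ eqs) , vs , vt) = (i , inj₁ eqs) , vt , vs

  climb-home : ∀ {v} t → Acc _<_ (toℕ t) → v ∈ bag′ t → Star (Linked v) t (node (home v))
  climb-home {v} t _ v∈ with climb v∈
  ... | inj₁ t≡home = subst (Star (Linked v) t) (trans (sym (node-toℕ t)) (cong node t≡home)) ε
  climb-home fzero _ _ | inj₂ (_ , () , _)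
  climb-home {v} (fsuc i) (acc below) v∈ | inj₂ (_ , refl , v∈up) =
    ((i , inj₁ (refl , refl)) , v∈ , v∈parent) ◅ climb-home (node (up (toℕ i))) (below parent<t) v∈parent
    where
    up≤size : up (toℕ i) ≤ size
    up≤size = ≤-trans (up≤ (toℕ i)) (<⇒≤ (toℕ<n i))
    v∈parent : v ∈ bag′ (node (up (toℕ i)))
    v∈parent = ∈-bags-node up≤size v∈up
    parent<t : toℕ (node (up (toℕ i))) < suc (toℕ i)
    parent<t = s≤s (subst (_≤ toℕ i) (sym (toℕ-node up≤size)) (up≤ (toℕ i)))

  decomposition : TreeDecomposition G
  decomposition = record
    { tree         = decompositionTree
    ; bag          = bag′
    ; cover-vertex = λ v → node (home v) , ∈-bags-node (home≤ v) (∈-home v)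
    ; cover-edge   = λ e → let (n , n≤ , u∈ , w∈) = edge-in-bag e
                           in node n , ∈-bags-node n≤ u∈ , ∈-bags-node n≤ w∈
    ; connected    = λ v s t v∈s v∈t → climb-home s (<-wellFounded _) v∈s
                                         ◅◅ reverse Linked-sym (climb-home t (<-wellFounded _) v∈t)
    }

  decomposition-width : ∀ {w} → (∀ n → length (bags n) ≤ suc w) → WidthAtMost decomposition w
  decomposition-width bound t = bound (toℕ t)

module CliqueTreeDecomposition (r k′ : ℕ) where

  k : ℕ
  k = 2 + k′

  Var′ : Set
  Var′ = V (Primal (F r k))

  TN : Set
  TN = TNode r

  nodeIndex : TN → ℕ
  nodeIndex a = index (proj₁ a)

  nodeAt : ℕ → TN
  nodeAt n = pathAt r n , length-pathAt r n

  nodeAt-nodeIndex : ∀ a → nodeAt (nodeIndex a) ≡ a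
  nodeAt-nodeIndex (p , le) with pathAt r (index p) | pathAt-index r p le | length-pathAt r (index p)
  ... | _ | refl | le′ = cong (p ,_) (≤-irrelevant le′ le)

  M : ℕ
  M = 2 ^ suc r

  nodeIndex<M : ∀ a → nodeIndex a < M
  nodeIndex<M (p , le) = <-≤-trans (<-trans (n<1+n _) (suc-index<2^ p)) (^-monoʳ-≤ 2 (s≤s le))

  parentNode : ∀ p → suc (length p) ≤ r → TN
  parentNode p le = p , ≤-trans (n≤1+n (length p)) le

  -- The clause of an edge hangs below the deeper of the two cliques it touches.
  lowerEnd : CTEdge r k → TN
  lowerEnd (inClique a _ _ _)  = a
  lowerEnd (across a b le _ _) = b ∷ a , le

  kk : ℕ
  kk = k * k

  K2 : ℕ
  K2 = kk + kk

  pairIndex : Fin k → Fin k → ℕ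
  pairIndex i j = toℕ j + toℕ i * k

  pairIndex<kk : ∀ i j → pairIndex i j < kk
  pairIndex<kk i j = m+kn<pn (toℕ<n j) (toℕ<n i)

  slot : CTEdge r k → ℕ
  slot (inClique _ i j _)  = pairIndex i j
  slot (across _ _ _ i j)  = kk + pairIndex i j

  slot<K2 : ∀ e → slot e < K2
  slot<K2 (inClique _ i j _) = <-≤-trans (pairIndex<kk i j) (m≤m+n kk kk)
  slot<K2 (across _ _ _ i j) = +-monoʳ-< kk (pairIndex<kk i j)

  inCliqueAt : TN → Fin k → Fin k → Maybe (CTEdge r k)
  inCliqueAt a i j with toℕ i <? toℕ j
  ... | yes i<j = just (inClique a i j i<j)
  ... | no _    = nothing

  acrossAt : TN → Fin k → Fin k → Maybe (CTEdge r k)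
  acrossAt ([] , _)     _ _ = nothing
  acrossAt (b ∷ a , le) i j = just (across a b le i j)

  pairAt : (Fin k → Fin k → Maybe (CTEdge r k)) → ℕ → Maybe (CTEdge r k)
  pairAt edge o = edge ((o / k) mod k) (o mod k)

  edgeAt : TN → ℕ → Maybe (CTEdge r k)
  edgeAt a o with o <? kk
  ... | yes _ = pairAt (inCliqueAt a) o
  ... | no _  = pairAt (acrossAt a) (o ∸ kk)

  pairAt-pairIndex : ∀ edge i j → pairAt edge (pairIndex i j) ≡ edge i j
  pairAt-pairIndex edge i j
    rewrite [m+kn]/n≡k (toℕ j) (toℕ i) k (toℕ<n j) | [m+kn]mod-n≡m j (toℕ i)
    = cong (λ i′ → edge i′ j) (toℕ-mod i)

  inCliqueAt-inClique : ∀ a i j i<j → inCliqueAt a i j ≡ just (inClique a i j i<j)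
  inCliqueAt-inClique a i j i<j with toℕ i <? toℕ j
  ... | yes i<j′ = cong (λ lt → just (inClique a i j lt)) (<-irrelevant i<j′ i<j)
  ... | no i≮j   = contradiction i<j i≮j

  edgeAt-slot : ∀ e → edgeAt (lowerEnd e) (slot e) ≡ just e
  edgeAt-slot (inClique a i j i<j) with pairIndex i j <? kk
  ... | yes _  = trans (pairAt-pairIndex (inCliqueAt a) i j) (inCliqueAt-inClique a i j i<j)
  ... | no ≮kk = contradiction (pairIndex<kk i j) ≮kk
  edgeAt-slot (across a b le i j) with kk + pairIndex i j <? kk
  ... | yes <kk = contradiction <kk (m+n≮m kk (pairIndex i j))
  ... | no _ rewrite m+n∸m≡n kk (pairIndex i j) = pairAt-pairIndex (acrossAt (b ∷ a , le)) i j

  data Piece : Set where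
    atNode   : TN → Piece
    atClause : CTEdge r k → Piece

  clauseOffset : CTEdge r k → ℕ
  clauseOffset e = slot e + nodeIndex (lowerEnd e) * K2

  -- Index M is left unused, so that every clause leaf is a successor.
  encode : Piece → ℕ
  encode (atNode a)   = nodeIndex a
  encode (atClause e) = suc (M + clauseOffset e)

  decode : ℕ → Maybe Piece
  decode n with n <? M
  ... | yes _ = just (atNode (nodeAt n))
  ... | no _  = Maybe.map atClause (edgeAt (nodeAt (offset / K2)) (offset % K2))
    where offset = pred n ∸ M

  decode-encode : ∀ x → decode (encode x) ≡ just x
  decode-encode (atNode a) with nodeIndex a <? M
  ... | yes _ = cong (just ∘′ atNode) (nodeAt-nodeIndex a)
  ... | no ≮M = contradiction (nodeIndex<M a) ≮M
  decode-encode (atClause e) with suc (M + clauseOffset e) <? M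
  ... | yes <M = contradiction (<-trans (n<1+n _) <M) (m+n≮m M _)
  ... | no _
    rewrite m+n∸m≡n M (clauseOffset e)
          | [m+kn]/n≡k (slot e) (nodeIndex (lowerEnd e)) K2 (slot<K2 e)
          | [m+kn]%n≡m (slot e) (nodeIndex (lowerEnd e)) K2 (slot<K2 e)
          | nodeAt-nodeIndex (lowerEnd e)
          | edgeAt-slot e
          = refl

  size : ℕ
  size = M + M * K2

  encode≤size : ∀ x → encode x ≤ size
  encode≤size (atNode a)   = ≤-trans (<⇒≤ (nodeIndex<M a)) (m≤m+n M _)
  encode≤size (atClause e) = subst (_≤ size) (+-suc M _)
    (+-monoʳ-≤ M (m+kn<pn (slot<K2 e) (nodeIndex<M (lowerEnd e))))

  up : ℕ → ℕ
  up n with n <? M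
  ... | yes _ = n / 2
  ... | no _  = (n ∸ M) / K2

  up≤ : ∀ n → up n ≤ n
  up≤ n with n <? M
  ... | yes _ = m/n≤m n 2
  ... | no _  = ≤-trans (m/n≤m (n ∸ M) K2) (m∸n≤m n M)

  up-child : ∀ b p (le : length (b ∷ p) ≤ r) → up (fromBit b + index p * 2) ≡ index p
  up-child b p le with fromBit b + index p * 2 <? M
  ... | yes _  = [m+kn]/n≡k (fromBit b) (index p) 2 (fromBit<2 b)
  ... | no ≮M = contradiction (<-trans (n<1+n _) (nodeIndex<M (b ∷ p , le))) ≮M

  up-clause : ∀ e → up (M + clauseOffset e) ≡ nodeIndex (lowerEnd e)
  up-clause e with M + clauseOffset e <? M
  ... | yes <M = contradiction <M (m+n≮m M (clauseOffset e))
  ... | no _ rewrite m+n∸m≡n M (clauseOffset e) = [m+kn]/n≡k (slot e) (nodeIndex (lowerEnd e)) K2 (slot<K2 e)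

  K : TN → List Var′
  K a = tabulate (λ i → inj₁ (a , i))

  contents : Piece → List Var′
  contents (atNode ([] , le))    = K ([] , le)
  contents (atNode (b ∷ p , le)) = K (b ∷ p , le) ++ K (parentNode p le)
  contents (atClause e)          = map proj₁ (clause (F r k) e)

  ∈-K⁺ : ∀ a i → inj₁ (a , i) ∈ K a
  ∈-K⁺ a i = ∈-tabulate⁺ {f = λ j → inj₁ (a , j)} i

  ∈-K⁻ : ∀ {a v} → v ∈ K a → ∃ λ i → v ≡ inj₁ (a , i)
  ∈-K⁻ = ∈-tabulate⁻

  K⊆contents : ∀ a i → inj₁ (a , i) ∈ contents (atNode a)
  K⊆contents a@([] , _)    i = ∈-K⁺ a i
  K⊆contents a@(_ ∷ _ , _) i = ∈-++⁺ˡ (∈-K⁺ a i)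

  bags : ℕ → List Var′
  bags = extend encode decode decode-encode contents

  bags-encode : ∀ x → bags (encode x) ≡ contents x
  bags-encode = extend-encode encode decode decode-encode contents

  home : Var′ → ℕ
  home (inj₁ (a , _)) = nodeIndex a
  home (inj₂ e)       = encode (atClause e)

  ∈-home : ∀ v → v ∈ bags (home v)
  ∈-home (inj₁ (a , i)) = subst (_ ∈_) (sym (bags-encode (atNode a))) (K⊆contents a i)
  ∈-home (inj₂ e)       = subst (_ ∈_) (sym (bags-encode (atClause e))) (there (here refl))

  home≤size : ∀ v → home v ≤ size
  home≤size (inj₁ (a , _)) = encode≤size (atNode a)
  home≤size (inj₂ e)       = encode≤size (atClause e)

  ascend : ∀ {v n} x → up n ≡ encode x → v ∈ contents x → v ∈ bags (up n)
  ascend x eq v∈ = subst (_ ∈_) (sym (trans (cong bags eq) (bags-encode x))) v∈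

  Climbs : Var′ → ℕ → Set
  Climbs v n = n ≡ home v ⊎ ∃ λ n′ → n ≡ suc n′ × v ∈ bags (up n′)

  climbs : ∀ {v} x → v ∈ contents x → Climbs v (encode x)
  climbs (atNode ([] , _)) v∈ with ∈-K⁻ v∈
  ... | _ , refl = inj₁ refl
  climbs (atNode (b ∷ p , le)) v∈ with ∈-++⁻ (K (b ∷ p , le)) v∈
  ... | inj₁ v∈K with ∈-K⁻ v∈K
  ...   | _ , refl = inj₁ refl
  climbs (atNode (b ∷ p , le)) v∈ | inj₂ v∈K with ∈-K⁻ v∈K
  ...   | i , refl = inj₂ (_ , refl , ascend (atNode (parentNode p le)) (up-child b p le) (K⊆contents _ i))
  climbs (atClause e) (there (here refl)) = inj₁ refl
  climbs (atClause (inClique a i j i<j)) (here refl) =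
    inj₂ (_ , refl , ascend (atNode a) (up-clause (inClique a i j i<j)) (K⊆contents a i))
  climbs (atClause (inClique a i j i<j)) (there (there (here refl))) =
    inj₂ (_ , refl , ascend (atNode a) (up-clause (inClique a i j i<j)) (K⊆contents a j))
  climbs (atClause (across a b le i j)) (here refl) =
    inj₂ (_ , refl , ascend (atNode (b ∷ a , le)) (up-clause (across a b le i j))
                             (∈-++⁺ʳ (K (b ∷ a , le)) (∈-K⁺ (parentNode a le) i)))
  climbs (atClause (across a b le i j)) (there (there (here refl))) =
    inj₂ (_ , refl , ascend (atNode (b ∷ a , le)) (up-clause (across a b le i j)) (K⊆contents _ j))

  climb : ∀ {v n} → v ∈ bags n → Climbs v n
  climb v∈ with ∈-extend⁻ encode decode decode-encode contents v∈
  ... | x , refl , v∈x = climbs x v∈x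

  edge-in-bag : ∀ (e : Ed (Primal (F r k))) → ∃ λ n → n ≤ size ×
                  proj₁ (ends (Primal (F r k)) e) ∈ bags n × proj₂ (ends (Primal (F r k)) e) ∈ bags n
  edge-in-bag (c , _ , _ , _ , (_ , x∈c) , (_ , y∈c)) =
    encode (atClause c) , encode≤size (atClause c) ,
    subst (_ ∈_) (sym (bags-encode (atClause c))) (∈-map⁺ proj₁ x∈c) ,
    subst (_ ∈_) (sym (bags-encode (atClause c))) (∈-map⁺ proj₁ y∈c)

  length-K : ∀ a → length (K a) ≡ k
  length-K a = length-tabulate (λ i → inj₁ (a , i))

  length-contents : ∀ x → length (contents x) ≤ suc (2 * k ∸ 1)
  length-contents (atNode ([] , _)) = ≤-trans (≤-reflexive (length-K _)) (m≤m+n k (k + 0))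
  length-contents (atNode (b ∷ p , le)) = ≤-reflexive (begin
    length (K (b ∷ p , le) ++ K (parentNode p le))  ≡⟨ length-++ (K (b ∷ p , le)) ⟩
    length (K (b ∷ p , le)) + length (K _)         ≡⟨ cong₂ _+_ (length-K _) (length-K _) ⟩
    k + k                                          ≡⟨ cong (k +_) (+-identityʳ k) ⟨
    k + (k + 0)                                    ∎)
    where open ≡-Reasoning
  length-contents (atClause _) = s≤s (s≤s (≤-trans {1} {1 * k} (s≤s z≤n) (m≤n+m (1 * k) k′)))

  open ClimbingDecomposition (Primal (F r k)) size up up≤ bags home
         home≤size ∈-home edge-in-bag climb
    using (decomposition; decomposition-width)

  treewidth≤2k-1 : TreewidthAtMost (Primal (F r k)) (2 * k ∸ 1)
  treewidth≤2k-1 =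
    decomposition , decomposition-width (length-extend≤ encode decode decode-encode contents length-contents)

lemma1 : (r k : ℕ) → 2 ≤ k → TreewidthAtMost (Primal (F r k)) (2 * k ∸ 1)
lemma1 r (suc (suc k′)) _ = CliqueTreeDecomposition.treewidth≤2k-1 r k′
lemma1 r zero ()
lemma1 r (suc zero) (s≤s ())
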